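{- Let $L$ be a complete lattice with order $\le$, joins $\bigvee$ and least element $\bot$, and $F:L\to L$. Define $a_0=\bot$, $a_{\beta+1}=F(a_\beta)$, $a_\gamma=\bigvee_{\beta<\gamma}a_\beta$ for limit ordinals $\gamma$, and $a_F=\bigvee_{\beta\in\mathrm{On}}a_\beta$. If $\preceq\subseteq L\times L$ is compatible with $\le$ and $F$ is quasi-continuous with respect to $\preceq$, then (i) $a_\beta\preceq a_{\beta'}$ for all ordinals $\beta\le\beta'$, and (ii) $a_F\preceq a_\omega$.
   Context: A relation $\preceq\subseteq L\times L$ is compatible with $\le$ if (C1) $a\preceq b$ and $b\le c$ imply $a\preceq c$, and (C2) for all $a\in L$ and every $A\subseteq\{b\in L\mid b\preceq a\}$, $\bigvee A\preceq a$. A subset $D\subseteq L$ is $\preceq$-directed if it is nonempty and for all $a,b\in D$, $a\preceq a$ and there is $c\in D$ with $a\preceq c$ and $b\preceq c$. For $a\in L$, $\mathrm{Dir}(a)$ is the set of $\preceq$-directed $D\subseteq L$ with $a\preceq\bigvee D$. $F$ is quasi-continuous if for all $a\in L$ and $D\in\mathrm{Dir}(a)$, $F(a)\preceq\bigvee_{b\in D}F(b)$. -}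

module Defs where

open import Level using (Level; 0ℓ; Lift) renaming (suc to lsuc)
open import Data.Empty using (⊥)
open import Data.Product using (Σ; Σ-syntax; _×_; _,_; proj₁; proj₂)
open import Data.Sum using (_⊎_; inj₁; inj₂)
open import Data.Nat as ℕ using (ℕ)
import Data.Nat.Properties as ℕP
import Data.Nat.Induction as ℕI
open import Relation.Nullary using (¬_)
open import Relation.Unary using (Pred; _∈_; _⊆_)
open import Relation.Binary using (Rel; Transitive; IsPartialOrder; Tri; tri<; tri≈; tri>)
open import Relation.Binary.PropositionalEquality using (_≡_; refl; cong)
open import Induction.WellFounded using (WellFounded)
import Relation.Binary.Construct.On as On

-- Carrier is a set (equality ≡); "subsets" of L are
-- predicates of level 1 (so that e.g. the image of a class-indexed
-- family of elements, such as {a_β | β ∈ On}, is a subset).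

Subset : Set → Set₂
Subset A = Pred A (lsuc 0ℓ)

record CompleteLattice : Set₂ where
  field
    Carrier        : Set
    _≤_            : Rel Carrier 0ℓ
    isPartialOrder : IsPartialOrder _≡_ _≤_
    ⋁              : Subset Carrier → Carrier
    ⋁-upper        : ∀ (A : Subset Carrier) {x} → x ∈ A → x ≤ ⋁ A
    ⋁-least        : ∀ (A : Subset Carrier) {y} → (∀ {x} → x ∈ A → x ≤ y) → ⋁ A ≤ y

  ⊥L : Carrier
  ⊥L = ⋁ (λ _ → Lift _ ⊥)

  Image : ∀ {I : Set₁} → (I → Carrier) → Subset Carrier
  Image {I} f y = Σ I (λ i → f i ≡ y)

record Ordinal : Set₁ where
  field
    Elt     : Set
    _<_     : Rel Elt 0ℓ
    <-trans : Transitive _<_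
    <-wf    : WellFounded _<_
    <-ext   : ∀ x y → (∀ z → (z < x → z < y) × (z < y → z < x)) → x ≡ y
    <-prop  : ∀ {x y} (p q : x < y) → p ≡ q

open Ordinal

_↓_ : (β : Ordinal) → Elt β → Ordinal
β ↓ x = record
  { Elt     = Σ (Elt β) (λ y → _<_ β y x)
  ; _<_     = λ u v → _<_ β (proj₁ u) (proj₁ v)
  ; <-trans = <-trans β
  ; <-wf    = On.wellFounded proj₁ (<-wf β)
  ; <-ext   = ext
  ; <-prop  = <-prop β
  }
  where
  pair≡ : ∀ {y z} → y ≡ z → (p : _<_ β y x) (q : _<_ β z x) → (y , p) ≡ (z , q)
  pair≡ refl p q = cong (_ ,_) (<-prop β p q)
  ext : ∀ (u v : Σ (Elt β) (λ y → _<_ β y x)) →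
        (∀ w → (_<_ β (proj₁ w) (proj₁ u) → _<_ β (proj₁ w) (proj₁ v))
             × (_<_ β (proj₁ w) (proj₁ v) → _<_ β (proj₁ w) (proj₁ u))) → u ≡ v
  ext (y , p) (z , q) H = pair≡ (<-ext β y z (λ w →
        (λ w<y → proj₁ (H (w , <-trans β w<y p)) w<y)
      , (λ w<z → proj₂ (H (w , <-trans β w<z q)) w<z))) p q

_≤ₒ_ : Ordinal → Ordinal → Set
β ≤ₒ γ = Σ (Elt β → Elt γ) λ f →
           (∀ {x y} → _<_ β x y → _<_ γ (f x) (f y))
         × (∀ x y′ → _<_ γ y′ (f x) → Σ (Elt β) λ y → _<_ β y x × f y ≡ y′)

_<ₒ_ : Ordinal → Ordinal → Set
β <ₒ γ = Σ (Elt γ) λ x → (β ≤ₒ (γ ↓ x)) × ((γ ↓ x) ≤ₒ β)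

IsZero : Ordinal → Set
IsZero γ = ¬ Elt γ

-- x is the greatest element of γ, i.e. γ = (γ↓x) + 1
IsGreatest : (γ : Ordinal) → Elt γ → Set
IsGreatest γ x = ∀ y → _<_ γ y x ⊎ y ≡ x

IsLimit : Ordinal → Set
IsLimit γ = Elt γ × (∀ x → Σ (Elt γ) λ y → _<_ γ x y)

ωₒ : Ordinal
ωₒ = record
  { Elt = ℕ ; _<_ = ℕ._<_ ; <-trans = ℕP.<-trans ; <-wf = ℕI.<-wellFounded
  ; <-ext = ext ; <-prop = ℕP.<-irrelevant }
  where
  ext : ∀ x y → (∀ z → (z ℕ.< x → z ℕ.< y) × (z ℕ.< y → z ℕ.< x)) → x ≡ y
  ext x y H with ℕP.<-cmp x y
  ... | tri< x<y _ _ = Data.Empty.⊥-elim (ℕP.<-irrefl refl (proj₂ (H x) x<y))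
    where import Data.Empty
  ... | tri≈ _ e _ = e
  ... | tri> _ _ y<x = Data.Empty.⊥-elim (ℕP.<-irrefl refl (proj₁ (H y) y<x))
    where import Data.Empty

-- The transfinite iteration a_β of F from ⊥, given by its defining
-- equations (a is any class function On → L satisfying them).

module _ (L : CompleteLattice) where
  open CompleteLattice L

  IsIteration : (Carrier → Carrier) → (Ordinal → Carrier) → Set₁
  IsIteration F a =
      (∀ γ → IsZero γ → a γ ≡ ⊥L)
    × (∀ γ x → IsGreatest γ x → a γ ≡ F (a (γ ↓ x)))
    × (∀ γ → IsLimit γ → a γ ≡ ⋁ (λ y → Σ Ordinal λ β → β <ₒ γ × a β ≡ y))

  aF : (Ordinal → Carrier) → Carrier
  aF a = ⋁ (Image a)

  Compatible : Rel Carrier 0ℓ → Set₂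
  Compatible _≼_ =
      (∀ {a b c} → a ≼ b → b ≤ c → a ≼ c)
    × (∀ a (A : Subset Carrier) → A ⊆ (λ b → Lift (lsuc 0ℓ) (b ≼ a)) → ⋁ A ≼ a)

  Directed : Rel Carrier 0ℓ → Subset Carrier → Set₁
  Directed _≼_ D =
      Σ Carrier (λ d → d ∈ D)
    × (∀ {a b} → a ∈ D → b ∈ D → (a ≼ a) × Σ Carrier λ c → c ∈ D × a ≼ c × b ≼ c)

  Dir : Rel Carrier 0ℓ → Carrier → Subset Carrier → Set₁
  Dir _≼_ a D = Directed _≼_ D × (a ≼ ⋁ D)

  QuasiContinuous : Rel Carrier 0ℓ → (Carrier → Carrier) → Set₂
  QuasiContinuous _≼_ F =
    ∀ a (D : Subset Carrier) → Dir _≼_ a D →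
      F a ≼ ⋁ (λ y → Σ Carrier λ b → b ∈ D × F b ≡ y)

-- An iterate a_β depends only on the order type of β, so (i) can be proved by induction on β′
-- and then on β.  Zero and limit stages β are handled by (C2).  For a successor β = δ + 1,
-- if β′ = δ′ + 1 then a_δ ≼ a_δ′ ≼ a_δ′ (induction) and quasi-continuity for the singleton
-- {a_δ′} gives F(a_δ) ≼ F(a_δ′); if β′ is a limit, the induction hypothesis makes the earlier
-- iterates a ≼-directed family whose join dominates a_β′, so quasi-continuity gives
-- F(a_δ) ≼ ⋁ F(a_γ) with every F(a_γ) = a_{γ+1} ≤ a_β′.  Part (ii) is the same limit
-- argument at β′ = ω, applied to every ordinal by induction.  Excluded middle is used to
-- classify ordinals as zero, successor or limit and to compare elements of a well-order.
module Submission where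

open import Defs
open import Level using (Level; 0ℓ; Lift; lift) renaming (suc to lsuc)
open import Data.Product using (_×_; Σ; _,_; proj₁; proj₂)
open import Data.Sum using (_⊎_; inj₁; inj₂)
open import Data.Empty using (⊥-elim)
open import Data.Nat using (suc)
open import Data.Nat.Properties using (n<1+n)
open import Relation.Nullary using (¬_; yes; no)
open import Relation.Binary using (Rel; IsPartialOrder)
open import Relation.Binary.PropositionalEquality using (_≡_; refl; sym; trans; cong; subst; module ≡-Reasoning)
open import Induction.WellFounded using (Acc; acc)
open import Axiom.ExcludedMiddle using (ExcludedMiddle)

open Ordinal

_≅ₒ_ : Ordinal → Ordinal → Set
β ≅ₒ γ = β ≤ₒ γ × γ ≤ₒ β

≤ₒ-refl : ∀ β → β ≤ₒ β
≤ₒ-refl β = (λ x → x) , (λ p → p) , (λ x y p → y , p , refl)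

≅ₒ-refl : ∀ β → β ≅ₒ β
≅ₒ-refl β = ≤ₒ-refl β , ≤ₒ-refl β

≤ₒ-trans : ∀ β γ δ → β ≤ₒ γ → γ ≤ₒ δ → β ≤ₒ δ
≤ₒ-trans β γ δ (f , f-mono , f-init) (g , g-mono , g-init) =
  (λ x → g (f x)) , (λ p → g-mono (f-mono p)) , init
  where
  init : ∀ x z → _<_ δ z (g (f x)) → Σ (Elt β) λ y → _<_ β y x × g (f y) ≡ z
  init x z z<gfx with g-init (f x) z z<gfx
  ... | w , w<fx , refl with f-init x w w<fx
  ...   | y , y<x , refl = y , y<x , refl

↓-≡ : ∀ β {x y z} → y ≡ z → (p : _<_ β y x) (q : _<_ β z x) → _≡_ {A = Elt (β ↓ x)} (y , p) (z , q)
↓-≡ β refl p q = cong (_ ,_) (<-prop β p q)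

↓-≤ₒ : ∀ β x → (β ↓ x) ≤ₒ β
↓-≤ₒ β x = proj₁ , (λ p → p) , λ u y p → (y , <-trans β p (proj₂ u)) , p , refl

↓-restrict : ∀ β γ (f : β ≤ₒ γ) x → (β ↓ x) ≤ₒ (γ ↓ proj₁ f x)
↓-restrict β γ (f , f-mono , f-init) x = (λ u → f (proj₁ u) , f-mono (proj₂ u)) , (λ p → f-mono p) , init
  where
  init : ∀ (u : Elt (β ↓ x)) (v : Elt (γ ↓ f x)) → _<_ γ (proj₁ v) (f (proj₁ u)) →
         Σ (Elt (β ↓ x)) λ w → _<_ β (proj₁ w) (proj₁ u)
                              × _≡_ {A = Elt (γ ↓ f x)} (f (proj₁ w) , f-mono (proj₂ w)) v
  init (y , y<x) (z , z<fx) z<fy with f-init y z z<fy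
  ... | w , w<y , fw≡z = (w , <-trans β w<y y<x) , w<y , ↓-≡ γ fw≡z _ z<fx

↓-↓-≤ₒ : ∀ β s w → ((β ↓ s) ↓ w) ≤ₒ (β ↓ proj₁ w)
↓-↓-≤ₒ β s = ↓-restrict (β ↓ s) β (↓-≤ₒ β s)

↓-≤ₒ-↓-↓ : ∀ β {x s} (x<s : _<_ β x s) → (β ↓ x) ≤ₒ ((β ↓ s) ↓ (x , x<s))
↓-≤ₒ-↓-↓ β {x} {s} x<s = (λ u → (proj₁ u , <-trans β (proj₂ u) x<s) , proj₂ u) , (λ p → p) , init
  where
  init : ∀ (u : Elt (β ↓ x)) (v : Elt ((β ↓ s) ↓ (x , x<s))) → _<_ β (proj₁ (proj₁ v)) (proj₁ u) →
         Σ (Elt (β ↓ x)) λ w → _<_ β (proj₁ w) (proj₁ u)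
           × _≡_ {A = Elt ((β ↓ s) ↓ (x , x<s))} ((proj₁ w , <-trans β (proj₂ w) x<s) , proj₂ w) v
  init u ((z , z<s) , z<x) z<u = (z , z<x) , z<u , cong (λ p → ((z , p) , z<x)) (<-prop β _ z<s)

↓-mono-< : ∀ β {x s} → _<_ β x s → (β ↓ x) ≤ₒ (β ↓ s)
↓-mono-< β {x} {s} x<s =
  ≤ₒ-trans (β ↓ x) ((β ↓ s) ↓ (x , x<s)) (β ↓ s) (↓-≤ₒ-↓-↓ β x<s) (↓-≤ₒ (β ↓ s) (x , x<s))

≤ₒ-unique : ∀ β γ (f g : β ≤ₒ γ) x → proj₁ f x ≡ proj₁ g x
≤ₒ-unique β γ (f , f-mono , f-init) (g , g-mono , g-init) x = go x (<-wf β x)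
  where
  go : ∀ x → Acc (_<_ β) x → f x ≡ g x
  go x (acc rs) = <-ext γ (f x) (g x) λ z → below-f⇒below-g z , below-g⇒below-f z
    where
    below-f⇒below-g : ∀ z → _<_ γ z (f x) → _<_ γ z (g x)
    below-f⇒below-g z z<fx with f-init x z z<fx
    ... | y , y<x , refl = subst (λ t → _<_ γ t (g x)) (sym (go y (rs y<x))) (g-mono y<x)
    below-g⇒below-f : ∀ z → _<_ γ z (g x) → _<_ γ z (f x)
    below-g⇒below-f z z<gx with g-init x z z<gx
    ... | y , y<x , refl = subst (λ t → _<_ γ t (f x)) (go y (rs y<x)) (f-mono y<x)

≅ₒ-section : ∀ β γ (e : β ≅ₒ γ) y → proj₁ (proj₁ e) (proj₁ (proj₂ e) y) ≡ y
≅ₒ-section β γ (f , g) = ≤ₒ-unique γ γ (≤ₒ-trans γ β γ g f) (≤ₒ-refl γ)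

↓-restrict⁻¹ : ∀ β γ (e : β ≅ₒ γ) x → (γ ↓ proj₁ (proj₁ e) x) ≤ₒ (β ↓ x)
↓-restrict⁻¹ β γ (f , g) x =
  subst (λ t → (γ ↓ proj₁ f x) ≤ₒ (β ↓ t)) (≅ₒ-section γ β (g , f) x) (↓-restrict γ β g (proj₁ f x))

↓-≅ₒ : ∀ β γ (e : β ≅ₒ γ) x → (β ↓ x) ≅ₒ (γ ↓ proj₁ (proj₁ e) x)
↓-≅ₒ β γ e x = ↓-restrict β γ (proj₁ e) x , ↓-restrict⁻¹ β γ e x

<ₒ-respʳ-≅ₒ : ∀ σ β γ → β ≅ₒ γ → σ <ₒ β → σ <ₒ γ
<ₒ-respʳ-≅ₒ σ β γ e (x , σ≤β↓x , β↓x≤σ) =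
  proj₁ (proj₁ e) x ,
  ≤ₒ-trans σ (β ↓ x) (γ ↓ proj₁ (proj₁ e) x) σ≤β↓x (proj₁ (↓-≅ₒ β γ e x)) ,
  ≤ₒ-trans (γ ↓ proj₁ (proj₁ e) x) (β ↓ x) σ (proj₂ (↓-≅ₒ β γ e x)) β↓x≤σ

IsZero-≅ₒ : ∀ β γ → β ≅ₒ γ → IsZero β → IsZero γ
IsZero-≅ₒ β γ (f , g) β-empty y = β-empty (proj₁ g y)

IsGreatest-≅ₒ : ∀ β γ (e : β ≅ₒ γ) x → IsGreatest β x → IsGreatest γ (proj₁ (proj₁ e) x)
IsGreatest-≅ₒ β γ e@((f , f-mono , _) , (g , _)) x x-greatest y with x-greatest (g y)
... | inj₁ gy<x = inj₁ (subst (λ t → _<_ γ t (f x)) (≅ₒ-section β γ e y) (f-mono gy<x))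
... | inj₂ gy≡x = inj₂ (trans (sym (≅ₒ-section β γ e y)) (cong f gy≡x))

IsLimit-≅ₒ : ∀ β γ → β ≅ₒ γ → IsLimit β → IsLimit γ
IsLimit-≅ₒ β γ e@((f , f-mono , _) , (g , _)) (x₀ , unbounded) =
  f x₀ , λ y → f (proj₁ (unbounded (g y))) ,
    subst (λ t → _<_ γ t (f (proj₁ (unbounded (g y))))) (≅ₒ-section β γ e y)
          (f-mono (proj₂ (unbounded (g y))))

ordinal-ind : ∀ {ℓ} (P : Ordinal → Set ℓ) →
              (∀ β → (∀ x γ → γ ≤ₒ (β ↓ x) → P γ) → P β) → ∀ β → P β
ordinal-ind P step β = step β (λ x γ γ≤β↓x → go x (<-wf β x) γ γ≤β↓x)
  where
  go : ∀ x → Acc (_<_ β) x → ∀ γ → γ ≤ₒ (β ↓ x) → P γ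
  go x (acc rs) γ f = step γ λ z δ δ≤γ↓z →
    let y = proj₁ f z
    in go (proj₁ y) (rs (proj₂ y)) δ
          (≤ₒ-trans δ (γ ↓ z) (β ↓ proj₁ y) δ≤γ↓z
            (≤ₒ-trans (γ ↓ z) ((β ↓ x) ↓ y) (β ↓ proj₁ y) (↓-restrict γ (β ↓ x) f z) (↓-↓-≤ₒ β x y)))

data Shape (γ : Ordinal) : Set where
  zero  : IsZero γ → Shape γ
  succ  : (x : Elt γ) → IsGreatest γ x → Shape γ
  limit : IsLimit γ → Shape γ

module Classical (lem : ∀ {ℓ : Level} → ExcludedMiddle ℓ) where

  <-trichotomy : ∀ β x y → _<_ β x y ⊎ (x ≡ y ⊎ _<_ β y x)
  <-trichotomy β x y = go x (<-wf β x) y (<-wf β y)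
    where
    go : ∀ x → Acc (_<_ β) x → ∀ y → Acc (_<_ β) y → _<_ β x y ⊎ (x ≡ y ⊎ _<_ β y x)
    go x (acc rx) y (acc ry) with lem {0ℓ} {_<_ β x y} | lem {0ℓ} {_<_ β y x}
    ... | yes x<y | _       = inj₁ x<y
    ... | no _    | yes y<x = inj₂ (inj₂ y<x)
    ... | no x≮y  | no y≮x  = inj₂ (inj₁ (<-ext β x y λ z → below-x⇒below-y z , below-y⇒below-x z))
      where
      below-x⇒below-y : ∀ z → _<_ β z x → _<_ β z y
      below-x⇒below-y z z<x with go z (rx z<x) y (acc ry)
      ... | inj₁ z<y         = z<y
      ... | inj₂ (inj₁ refl) = ⊥-elim (y≮x z<x)
      ... | inj₂ (inj₂ y<z)  = ⊥-elim (y≮x (<-trans β y<z z<x))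
      below-y⇒below-x : ∀ z → _<_ β z y → _<_ β z x
      below-y⇒below-x z z<y with go x (acc rx) z (ry z<y)
      ... | inj₁ x<z         = ⊥-elim (x≮y (<-trans β x<z z<y))
      ... | inj₂ (inj₁ refl) = ⊥-elim (x≮y z<y)
      ... | inj₂ (inj₂ z<x)  = z<x

  shape : ∀ γ → Shape γ
  shape γ with lem {0ℓ} {Elt γ} | lem {0ℓ} {Σ (Elt γ) (IsGreatest γ)}
  ... | no γ-empty | _                  = zero γ-empty
  ... | yes _      | yes (x , greatest) = succ x greatest
  ... | yes x₀     | no no-greatest     = limit (x₀ , unbounded)
    where
    unbounded : ∀ x → Σ (Elt γ) λ y → _<_ γ x y
    unbounded x with lem {0ℓ} {Σ (Elt γ) λ y → _<_ γ x y}
    ... | yes above = above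
    ... | no nothing-above = ⊥-elim (no-greatest (x , greatest))
      where
      greatest : IsGreatest γ x
      greatest y with <-trichotomy γ y x
      ... | inj₁ y<x        = inj₁ y<x
      ... | inj₂ (inj₁ y≡x) = inj₂ y≡x
      ... | inj₂ (inj₂ x<y) = ⊥-elim (nothing-above (y , x<y))

  least : ∀ β (P : Elt β → Set) x → P x → Σ (Elt β) λ m → P m × (∀ z → _<_ β z m → ¬ P z)
  least β P x Px = go x (<-wf β x) Px
    where
    go : ∀ x → Acc (_<_ β) x → P x → Σ (Elt β) λ m → P m × (∀ z → _<_ β z m → ¬ P z)
    go x (acc rs) Px with lem {0ℓ} {Σ (Elt β) λ z → _<_ β z x × P z}
    ... | yes (z , z<x , Pz) = go z (rs z<x) Pz
    ... | no none-below      = x , Px , λ z z<x Pz → none-below (z , z<x , Pz)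

  successor : ∀ β x → Σ (Elt β) (_<_ β x) →
              Σ (Elt β) λ s → Σ (_<_ β x s) λ x<s → IsGreatest (β ↓ s) (x , x<s)
  successor β x (y , x<y) with least β (_<_ β x) y x<y
  ... | s , x<s , s-least = s , x<s , greatest
    where
    greatest : IsGreatest (β ↓ s) (x , x<s)
    greatest (z , z<s) with <-trichotomy β z x
    ... | inj₁ z<x        = inj₁ z<x
    ... | inj₂ (inj₁ z≡x) = inj₂ (↓-≡ β z≡x z<s x<s)
    ... | inj₂ (inj₂ x<z) = ⊥-elim (s-least z z<s x<z)

  module Iteration (L : CompleteLattice) (F : CompleteLattice.Carrier L → CompleteLattice.Carrier L)
                   (a : Ordinal → CompleteLattice.Carrier L) (iteration : IsIteration L F a)
                   (_≼_ : Rel (CompleteLattice.Carrier L) 0ℓ)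
                   (compatible : Compatible L _≼_) (quasi-continuous : QuasiContinuous L _≼_ F) where
    open CompleteLattice L
    module ≤ = IsPartialOrder isPartialOrder

    Below : Ordinal → Subset Carrier
    Below γ y = Σ Ordinal λ β → β <ₒ γ × a β ≡ y

    a-zero : ∀ γ → IsZero γ → a γ ≡ ⊥L
    a-zero = proj₁ iteration

    a-succ : ∀ γ x → IsGreatest γ x → a γ ≡ F (a (γ ↓ x))
    a-succ = proj₁ (proj₂ iteration)

    a-limit : ∀ γ → IsLimit γ → a γ ≡ ⋁ (Below γ)
    a-limit = proj₂ (proj₂ iteration)

    ≼-≤-trans : ∀ {x y z} → x ≼ y → y ≤ z → x ≼ z
    ≼-≤-trans = proj₁ compatible

    ⋁-≼ : ∀ c (A : Subset Carrier) → (∀ {x} → A x → Lift (lsuc 0ℓ) (x ≼ c)) → ⋁ A ≼ c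
    ⋁-≼ c A = proj₂ compatible c A

    ⊥L-≼ : ∀ c → ⊥L ≼ c
    ⊥L-≼ c = ⋁-≼ c _ λ { (lift ()) }

    F-mono-≼ : ∀ {u v} → u ≼ v → v ≼ v → F u ≼ F v
    F-mono-≼ {u} {v} u≼v v≼v =
      ≼-≤-trans (quasi-continuous u D (directed , ≼-≤-trans u≼v (⋁-upper D (lift refl)))) (⋁-least _ F[D]≤Fv)
      where
      D : Subset Carrier
      D y = Lift (lsuc 0ℓ) (y ≡ v)
      directed : Directed L _≼_ D
      directed = (v , lift refl) , λ { (lift refl) (lift refl) → v≼v , v , lift refl , v≼v , v≼v }
      F[D]≤Fv : ∀ {y} → (Σ Carrier λ b → D b × F b ≡ y) → y ≤ F v
      F[D]≤Fv (_ , lift refl , refl) = ≤.refl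

    ⋁Below-≤ : ∀ β γ → β ≅ₒ γ → ⋁ (Below β) ≤ ⋁ (Below γ)
    ⋁Below-≤ β γ e = ⋁-least _ λ { (σ , σ<β , refl) → ⋁-upper _ (σ , <ₒ-respʳ-≅ₒ σ β γ e σ<β , refl) }

    a-≅ₒ : ∀ β γ → β ≅ₒ γ → a β ≡ a γ
    a-≅ₒ = ordinal-ind (λ β → ∀ γ → β ≅ₒ γ → a β ≡ a γ) step
      where
      step : ∀ β → (∀ x δ → δ ≤ₒ (β ↓ x) → ∀ γ → δ ≅ₒ γ → a δ ≡ a γ) → ∀ γ → β ≅ₒ γ → a β ≡ a γ
      step β ih γ e with shape β
      ... | zero β-empty = trans (a-zero β β-empty) (sym (a-zero γ (IsZero-≅ₒ β γ e β-empty)))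
      ... | succ x greatest = begin
        a β                             ≡⟨ a-succ β x greatest ⟩
        F (a (β ↓ x))                   ≡⟨ cong F (ih x (β ↓ x) (≤ₒ-refl (β ↓ x)) _ (↓-≅ₒ β γ e x)) ⟩
        F (a (γ ↓ proj₁ (proj₁ e) x))   ≡⟨ sym (a-succ γ _ (IsGreatest-≅ₒ β γ e x greatest)) ⟩
        a γ                             ∎
        where open ≡-Reasoning
      ... | limit β-limit = begin
        a β             ≡⟨ a-limit β β-limit ⟩
        ⋁ (Below β)     ≡⟨ ≤.antisym (⋁Below-≤ β γ e) (⋁Below-≤ γ β (proj₂ e , proj₁ e)) ⟩
        ⋁ (Below γ)     ≡⟨ sym (a-limit γ (IsLimit-≅ₒ β γ e β-limit)) ⟩
        a γ             ∎
        where open ≡-Reasoning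

    a-↓-≤-limit : ∀ β → IsLimit β → ∀ x → a (β ↓ x) ≤ a β
    a-↓-≤-limit β β-limit x =
      subst (a (β ↓ x) ≤_) (sym (a-limit β β-limit)) (⋁-upper _ ((β ↓ x) , (x , ≅ₒ-refl (β ↓ x)) , refl))

    F-a-↓-≤-limit : ∀ β → IsLimit β → ∀ x → F (a (β ↓ x)) ≤ a β
    F-a-↓-≤-limit β β-limit x with successor β x (proj₂ β-limit x)
    ... | s , x<s , greatest = subst (_≤ a β) a[β↓s]≡F[a[β↓x]] (a-↓-≤-limit β β-limit s)
      where
      a[β↓s]≡F[a[β↓x]] : a (β ↓ s) ≡ F (a (β ↓ x))
      a[β↓s]≡F[a[β↓x]] = trans (a-succ (β ↓ s) (x , x<s) greatest)
                               (cong F (a-≅ₒ _ _ (↓-↓-≤ₒ β s (x , x<s) , ↓-≤ₒ-↓-↓ β x<s)))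

    Dominates : Ordinal → Set₁
    Dominates β′ = ∀ β → β ≤ₒ β′ → a β ≼ a β′

    F-≼-limit : ∀ β′ → IsLimit β′ → (∀ x → Dominates (β′ ↓ x)) → ∀ {u} → u ≼ a β′ → F u ≼ a β′
    F-≼-limit β′ β′-limit dominates-↓ {u} u≼aβ′ =
      ≼-≤-trans (quasi-continuous u D (directed , ≼-≤-trans u≼aβ′ aβ′≤⋁D)) (⋁-least _ F[D]≤aβ′)
      where
      D : Subset Carrier
      D v = Lift (lsuc 0ℓ) (Σ (Elt β′) λ x → a (β′ ↓ x) ≡ v)
      aβ′≤⋁D : a β′ ≤ ⋁ D
      aβ′≤⋁D = subst (_≤ ⋁ D) (sym (a-limit β′ β′-limit)) (⋁-least _ λ where
        (σ , (x , σ≤β′↓x , β′↓x≤σ) , refl) →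
          subst (_≤ ⋁ D) (a-≅ₒ _ _ (β′↓x≤σ , σ≤β′↓x)) (⋁-upper D (lift (x , refl))))
      ≼-refl : ∀ x → a (β′ ↓ x) ≼ a (β′ ↓ x)
      ≼-refl x = dominates-↓ x (β′ ↓ x) (≤ₒ-refl (β′ ↓ x))
      bound : ∀ {b c} → D b → D c → (b ≼ b) × Σ Carrier λ e → D e × b ≼ e × c ≼ e
      bound (lift (x , refl)) (lift (y , refl)) with <-trichotomy β′ x y
      ... | inj₁ x<y         = ≼-refl x , _ , lift (y , refl) , dominates-↓ y _ (↓-mono-< β′ x<y) , ≼-refl y
      ... | inj₂ (inj₁ refl) = ≼-refl x , _ , lift (x , refl) , ≼-refl x , ≼-refl x
      ... | inj₂ (inj₂ y<x)  = ≼-refl x , _ , lift (x , refl) , ≼-refl x , dominates-↓ x _ (↓-mono-< β′ y<x)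
      directed : Directed L _≼_ D
      directed = (_ , lift (proj₁ β′-limit , refl)) , bound
      F[D]≤aβ′ : ∀ {y} → (Σ Carrier λ b → D b × F b ≡ y) → y ≤ a β′
      F[D]≤aβ′ (_ , lift (x , refl) , refl) = F-a-↓-≤-limit β′ β′-limit x

    F-a-≼ : ∀ β′ → (∀ x → Dominates (β′ ↓ x)) → ∀ β y → β ≤ₒ β′ → F (a (β ↓ y)) ≼ a β′
    F-a-≼ β′ dominates-↓ β y f@(f₀ , _) with shape β′
    ... | zero β′-empty = ⊥-elim (β′-empty (f₀ y))
    ... | succ x greatest = subst (F (a (β ↓ y)) ≼_) (sym (a-succ β′ x greatest))
          (F-mono-≼ (dominates-↓ x (β ↓ y) β↓y≤β′↓x) (dominates-↓ x (β′ ↓ x) (≤ₒ-refl (β′ ↓ x))))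
      where
      β↓y≤β′↓x : (β ↓ y) ≤ₒ (β′ ↓ x)
      β↓y≤β′↓x with greatest (f₀ y)
      ... | inj₁ fy<x = ≤ₒ-trans (β ↓ y) (β′ ↓ f₀ y) (β′ ↓ x) (↓-restrict β β′ f y) (↓-mono-< β′ fy<x)
      ... | inj₂ refl = ↓-restrict β β′ f y
    ... | limit β′-limit = F-≼-limit β′ β′-limit dominates-↓
          (≼-≤-trans (dominates-↓ (f₀ y) (β ↓ y) (↓-restrict β β′ f y)) (a-↓-≤-limit β′ β′-limit (f₀ y)))

    a-≼-from-below : ∀ β c → (∀ y → a (β ↓ y) ≼ c) → (∀ y → F (a (β ↓ y)) ≼ c) → a β ≼ c
    a-≼-from-below β c below F-below with shape β
    ... | zero β-empty = subst (_≼ c) (sym (a-zero β β-empty)) (⊥L-≼ c)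
    ... | succ y greatest = subst (_≼ c) (sym (a-succ β y greatest)) (F-below y)
    ... | limit β-limit = subst (_≼ c) (sym (a-limit β β-limit)) (⋁-≼ c _ λ where
          (σ , (y , σ≤β↓y , β↓y≤σ) , refl) → lift (subst (_≼ c) (a-≅ₒ _ _ (β↓y≤σ , σ≤β↓y)) (below y)))

    dominates : ∀ β′ → Dominates β′
    dominates = ordinal-ind Dominates λ β′ ih →
      let dominates-↓ x = ih x (β′ ↓ x) (≤ₒ-refl (β′ ↓ x))
      in ordinal-ind (λ β → β ≤ₒ β′ → a β ≼ a β′) λ β ih′ f →
           a-≼-from-below β (a β′)
             (λ y → ih′ y (β ↓ y) (≤ₒ-refl (β ↓ y)) (≤ₒ-trans (β ↓ y) β β′ (↓-≤ₒ β y) f))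
             (λ y → F-a-≼ β′ dominates-↓ β y f)

    ω-limit : IsLimit ωₒ
    ω-limit = 0 , λ n → suc n , n<1+n n

    a-≼-a-ω : ∀ β → a β ≼ a ωₒ
    a-≼-a-ω = ordinal-ind (λ β → a β ≼ a ωₒ) λ β ih →
      a-≼-from-below β (a ωₒ) (λ y → ih y (β ↓ y) (≤ₒ-refl (β ↓ y)))
        (λ y → F-≼-limit ωₒ ω-limit (λ n → dominates (ωₒ ↓ n)) (ih y (β ↓ y) (≤ₒ-refl (β ↓ y))))

    aF-≼-a-ω : aF L a ≼ a ωₒ
    aF-≼-a-ω = ⋁-≼ (a ωₒ) (Image a) λ { (β , refl) → lift (a-≼-a-ω β) }

mainTheorem10 : (∀ {ℓ : Level} → ExcludedMiddle ℓ) →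
    (L : CompleteLattice) → (F : CompleteLattice.Carrier L → CompleteLattice.Carrier L) →
    (a : Ordinal → CompleteLattice.Carrier L) → IsIteration L F a →
    (_≼_ : Rel (CompleteLattice.Carrier L) Level.zero) →
    Compatible L _≼_ → QuasiContinuous L _≼_ F →
    (∀ β β′ → β ≤ₒ β′ → a β ≼ a β′) × (aF L a ≼ a ωₒ)
mainTheorem10 lem L F a iteration _≼_ compatible quasi-continuous =
  (λ β β′ → dominates β′ β) , aF-≼-a-ω
  where open Classical.Iteration lem L F a iteration _≼_ compatible quasi-continuous
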